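{- (1) For every $\lambda$-context $c$, $\mathrm{lev}^{n}(c) = \mathrm{lev}(c^{n})$. (2) For all $t, s \in \Lambda_{\mathcal{O}}$ and $k\in\mathbb{N}$: $t \to_{\beta:k} s$ iff $t^n \to_{!\beta:k} s^n$; and $t \to_{\mathbf{o}:k} s$ iff $t^n \to_{\mathbf{o}:k} s^n$, for any $\mathbf{o}\in\mathcal{O}$. (3) For every $t\in\Lambda_{\mathcal{O}}$, $\mathrm{ll}^n(t) = \mathrm{ll}(t^n)$.
   Context: Fix operators $\mathcal{O}$ with arities. $\lambda$-terms $t ::= x\mid\lambda x.t\mid ts\mid\mathbf{o}(t_1,\dots,t_k)$ (set $\Lambda_{\mathcal{O}}$) and $\lambda$-contexts $c ::= [\cdot]\mid tc\mid ct\mid \lambda x.c\mid \mathbf{o}(t_1,\dots,c,\dots,t_k)$; bang terms $T ::= x\mid\lambda x.T\mid TS\mid !T\mid \mathbf{o}(T_1,\dots,T_k)$ and bang contexts $C ::= [\cdot]\mid\lambda x.C\mid TC\mid CT\mid !C\mid\mathbf{o}(T_1,\dots,C,\dots,T_k)$. Rules: $(\lambda x.t)s\mapsto_\beta t[s/x]$, $(\lambda x.T)\,!S\mapsto_{!\beta}T[S/x]$, and for each $\mathbf{o}$ a rule $\mapsto_{\mathbf{o}}$ with left-hand sides of shape $\mathbf{o}(\dots)$; on bang terms $\mapsto_{\mathbf{o}}$ is the image under $(\cdot)^n$ of the rule on $\lambda$-terms. CbN translation of terms: $x^n=x$, $(\lambda x.t)^n=\lambda x.t^n$, $\mathbf{o}(t_1,\dots)^n=\mathbf{o}(t_1^n,\dots)$,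 $(ts)^n=t^n\,!(s^n)$; of contexts: $[\cdot]^n=[\cdot]$, $(\lambda x.c)^n=\lambda x.c^n$, $\mathbf{o}(t_1,\dots,c,\dots,t_k)^n=\mathbf{o}(t_1^n,\dots,c^n,\dots,t_k^n)$, $(ct)^n=c^n\,!(t^n)$, $(tc)^n=t^n\,!(c^n)$. Bang level: $\mathrm{lev}([\cdot])=0$, $\mathrm{lev}(\lambda x.C)=\mathrm{lev}(CT)=\mathrm{lev}(TC)=\mathrm{lev}(C)$, $\mathrm{lev}(!C)=\mathrm{lev}(\mathbf{o}(\dots,C,\dots))=\mathrm{lev}(C)+1$. CbN level: $\mathrm{lev}^n([\cdot])=0$, $\mathrm{lev}^n(\lambda x.c)=\mathrm{lev}^n(ct)=\mathrm{lev}^n(c)$, $\mathrm{lev}^n(tc)=\mathrm{lev}^n(c)+1$, $\mathrm{lev}^n(\mathbf{o}(\dots,c,\dots))=\mathrm{lev}^n(c)+1$. A step $C[R]\to_\rho C[R']$ with $R\mapsto_\rho R'$ is at level $k$ (written $\to_{\rho:k}$) if the level of $C$ is $k$ (using $\mathrm{lev}^n$ for $\lambda$-terms, $\mathrm{lev}$ for bang terms). Least level: $\mathrm{ll}^n(t)=\inf\{\mathrm{lev}^n(c)\mid t=c[r], r \text{ a } \beta\text{ - or } \mathbf{o}\text{ -redex}\}$, and $\mathrm{ll}(T)=\inf\{\mathrm{lev}(C)\mid T=C[R], R\text{ a } !\beta\text{ - or }\mathbf{o}\text{ -redex}\}$, values in $\mathbb{N}\cup\{\infty\}$. -}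

module Defs where

open import Data.Nat using (ℕ; zero; suc; _+_)
open import Data.Vec using (Vec; []; _∷_; _++_; cast)
open import Data.Product using (Σ; ∃; _×_; _,_)
open import Data.Sum using (_⊎_)
open import Relation.Binary.PropositionalEquality using (_≡_)

data ℕ∞ : Set where
  fin : ℕ → ℕ∞
  ∞   : ℕ∞

data _≤∞_ : ℕ∞ → ℕ∞ → Set where
  fin≤fin : ∀ {m n} → m Data.Nat.≤ n → fin m ≤∞ fin n
  _≤∞∞    : ∀ (x : ℕ∞) → x ≤∞ ∞

LowerBound : (ℕ → Set) → ℕ∞ → Set
LowerBound P v = ∀ n → P n → v ≤∞ fin n

IsInf : (ℕ → Set) → ℕ∞ → Set
IsInf P v = LowerBound P v × (∀ w → LowerBound P w → w ≤∞ v)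

-- The theory is parametrised by a set of operators with arities.
-- Terms are in de Bruijn notation (terms up to α-equivalence).
module Theory (Op : Set) (ar : Op → ℕ) where

  data Λ : Set where
    var : ℕ → Λ
    lam : Λ → Λ
    app : Λ → Λ → Λ
    op  : (o : Op) → Vec Λ (ar o) → Λ

  -- λ-contexts; opC o eq ts c us is  o(ts , c , us)  (c at position length ts)
  data Ctx : Set where
    hole : Ctx
    lamC : Ctx → Ctx
    appL : Ctx → Λ → Ctx
    appR : Λ → Ctx → Ctx
    opC  : (o : Op) {m n : ℕ} → m + suc n ≡ ar o → Vec Λ m → Ctx → Vec Λ n → Ctx

  _⟦_⟧ : Ctx → Λ → Λ
  hole ⟦ r ⟧ = r
  lamC c ⟦ r ⟧ = lam (c ⟦ r ⟧)
  appL c t ⟦ r ⟧ = app (c ⟦ r ⟧) t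
  appR t c ⟦ r ⟧ = app t (c ⟦ r ⟧)
  opC o eq ts c us ⟦ r ⟧ = op o (cast eq (ts ++ (c ⟦ r ⟧ ∷ us)))

  ext : (ℕ → ℕ) → ℕ → ℕ
  ext ρ zero = zero
  ext ρ (suc x) = suc (ρ x)

  mutual
    ren : (ℕ → ℕ) → Λ → Λ
    ren ρ (var x) = var (ρ x)
    ren ρ (lam t) = lam (ren (ext ρ) t)
    ren ρ (app t s) = app (ren ρ t) (ren ρ s)
    ren ρ (op o ts) = op o (renV ρ ts)

    renV : ∀ {k} → (ℕ → ℕ) → Vec Λ k → Vec Λ k
    renV ρ [] = []
    renV ρ (t ∷ ts) = ren ρ t ∷ renV ρ ts

  exts : (ℕ → Λ) → ℕ → Λ
  exts σ zero = var zero
  exts σ (suc x) = ren suc (σ x)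

  mutual
    sub : (ℕ → Λ) → Λ → Λ
    sub σ (var x) = σ x
    sub σ (lam t) = lam (sub (exts σ) t)
    sub σ (app t s) = app (sub σ t) (sub σ s)
    sub σ (op o ts) = op o (subV σ ts)

    subV : ∀ {k} → (ℕ → Λ) → Vec Λ k → Vec Λ k
    subV σ [] = []
    subV σ (t ∷ ts) = sub σ t ∷ subV σ ts

  _[_/0] : Λ → Λ → Λ
  t [ s /0] = sub σ t
    where
      σ : ℕ → Λ
      σ zero = s
      σ (suc x) = var x

  data _↦β_ : Λ → Λ → Set where
    β : ∀ t s → app (lam t) s ↦β (t [ s /0])

  levn : Ctx → ℕ
  levn hole = 0
  levn (lamC c) = levn c
  levn (appL c t) = levn c
  levn (appR t c) = suc (levn c)
  levn (opC o eq ts c us) = suc (levn c)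

  data B : Set where
    bvar : ℕ → B
    blam : B → B
    bapp : B → B → B
    !_   : B → B
    bop  : (o : Op) → Vec B (ar o) → B

  data BCtx : Set where
    bhole : BCtx
    blamC : BCtx → BCtx
    bappR : B → BCtx → BCtx
    bappL : BCtx → B → BCtx
    !C    : BCtx → BCtx
    bopC  : (o : Op) {m n : ℕ} → m + suc n ≡ ar o → Vec B m → BCtx → Vec B n → BCtx

  _⟪_⟫ : BCtx → B → B
  bhole ⟪ R ⟫ = R
  blamC C ⟪ R ⟫ = blam (C ⟪ R ⟫)
  bappR T C ⟪ R ⟫ = bapp T (C ⟪ R ⟫)
  bappL C T ⟪ R ⟫ = bapp (C ⟪ R ⟫) T
  !C C ⟪ R ⟫ = ! (C ⟪ R ⟫)
  bopC o eq Ts C Us ⟪ R ⟫ = bop o (cast eq (Ts ++ (C ⟪ R ⟫ ∷ Us)))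

  mutual
    bren : (ℕ → ℕ) → B → B
    bren ρ (bvar x) = bvar (ρ x)
    bren ρ (blam t) = blam (bren (ext ρ) t)
    bren ρ (bapp t s) = bapp (bren ρ t) (bren ρ s)
    bren ρ (! t) = ! (bren ρ t)
    bren ρ (bop o ts) = bop o (brenV ρ ts)

    brenV : ∀ {k} → (ℕ → ℕ) → Vec B k → Vec B k
    brenV ρ [] = []
    brenV ρ (t ∷ ts) = bren ρ t ∷ brenV ρ ts

  bexts : (ℕ → B) → ℕ → B
  bexts σ zero = bvar zero
  bexts σ (suc x) = bren suc (σ x)

  mutual
    bsub : (ℕ → B) → B → B
    bsub σ (bvar x) = σ x
    bsub σ (blam t) = blam (bsub (bexts σ) t)
    bsub σ (bapp t s) = bapp (bsub σ t) (bsub σ s)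
    bsub σ (! t) = ! (bsub σ t)
    bsub σ (bop o ts) = bop o (bsubV σ ts)

    bsubV : ∀ {k} → (ℕ → B) → Vec B k → Vec B k
    bsubV σ [] = []
    bsubV σ (t ∷ ts) = bsub σ t ∷ bsubV σ ts

  _⟨_/0⟩ : B → B → B
  T ⟨ S /0⟩ = bsub σ T
    where
      σ : ℕ → B
      σ zero = S
      σ (suc x) = bvar x

  data _↦!β_ : B → B → Set where
    !β : ∀ T S → bapp (blam T) (! S) ↦!β (T ⟨ S /0⟩)

  lev : BCtx → ℕ
  lev bhole = 0
  lev (blamC C) = lev C
  lev (bappR T C) = lev C
  lev (bappL C T) = lev C
  lev (!C C) = suc (lev C)
  lev (bopC o eq Ts C Us) = suc (lev C)

  mutual
    tn : Λ → B
    tn (var x) = bvar x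
    tn (lam t) = blam (tn t)
    tn (app t s) = bapp (tn t) (! (tn s))
    tn (op o ts) = bop o (tnV ts)

    tnV : ∀ {k} → Vec Λ k → Vec B k
    tnV [] = []
    tnV (t ∷ ts) = tn t ∷ tnV ts

  cn : Ctx → BCtx
  cn hole = bhole
  cn (lamC c) = blamC (cn c)
  cn (appL c t) = bappL (cn c) (! (tn t))
  cn (appR t c) = bappR (tn t) (!C (cn c))
  cn (opC o eq ts c us) = bopC o eq (tnV ts) (cn c) (tnV us)

  -- Reduction, parametrised by the operator rules  R o : Λ → Λ → Set
  -- (R o t s  means  t ↦_o s  on λ-terms).
  module Rules (R : Op → Λ → Λ → Set) where

    -- the rule ↦_o on bang terms: the image under (·)^n of the rule on λ-terms
    data BR (o : Op) : B → B → Set where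
      img : ∀ {t s} → R o t s → BR o (tn t) (tn s)

    _→β⟨_⟩_ : Λ → ℕ → Λ → Set
    t →β⟨ k ⟩ s = Σ Ctx λ c → Σ Λ λ r → Σ Λ λ r' →
      (r ↦β r') × (t ≡ c ⟦ r ⟧) × (s ≡ c ⟦ r' ⟧) × (levn c ≡ k)

    _→o[_]⟨_⟩_ : Λ → Op → ℕ → Λ → Set
    t →o[ o ]⟨ k ⟩ s = Σ Ctx λ c → Σ Λ λ r → Σ Λ λ r' →
      R o r r' × (t ≡ c ⟦ r ⟧) × (s ≡ c ⟦ r' ⟧) × (levn c ≡ k)

    _→!β⟨_⟩_ : B → ℕ → B → Set
    T →!β⟨ k ⟩ S = Σ BCtx λ C → Σ B λ R₀ → Σ B λ R₁ →
      (R₀ ↦!β R₁) × (T ≡ C ⟪ R₀ ⟫) × (S ≡ C ⟪ R₁ ⟫) × (lev C ≡ k)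

    _→bo[_]⟨_⟩_ : B → Op → ℕ → B → Set
    T →bo[ o ]⟨ k ⟩ S = Σ BCtx λ C → Σ B λ R₀ → Σ B λ R₁ →
      BR o R₀ R₁ × (T ≡ C ⟪ R₀ ⟫) × (S ≡ C ⟪ R₁ ⟫) × (lev C ≡ k)

    Redex : Λ → Set
    Redex r = (∃ λ r' → r ↦β r') ⊎ (∃ λ o → ∃ λ r' → R o r r')

    BRedex : B → Set
    BRedex r = (∃ λ r' → r ↦!β r') ⊎ (∃ λ o → ∃ λ r' → BR o r r')

    RedexLevn : Λ → ℕ → Set
    RedexLevn t k = Σ Ctx λ c → Σ Λ λ r → Redex r × (t ≡ c ⟦ r ⟧) × (levn c ≡ k)

    RedexLev : B → ℕ → Set
    RedexLev T k = Σ BCtx λ C → Σ B λ r → BRedex r × (T ≡ C ⟪ r ⟫) × (lev C ≡ k)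

    -- "ll^n(t) = v"  and  "ll(T) = v"  (infimum in ℕ ∪ {∞})
    lln≡ : Λ → ℕ∞ → Set
    lln≡ t v = IsInf (RedexLevn t) v

    ll≡ : B → ℕ∞ → Set
    ll≡ T v = IsInf (RedexLev T) v

-- The CbN translation is injective, commutes with substitution and with plugging
-- (tn (c ⟦ r ⟧) ≡ cn c ⟪ tn r ⟫), and each constructor of a λ-context is sent to
-- a bang-context constructor of the same level, so it preserves levels and redexes.
-- Conversely, every bang context C with tn t ≡ C ⟪ X ⟫ and X not of the form ! Y is
-- the translation of a λ-context whose hole holds a preimage of X: a hole right
-- below the argument of an application would force X to be a bang. Since the
-- sources of !β- and o-steps are never bangs, steps and redex occurrences of tn t
-- at level k are exactly the translations of those of t at level k.
module Submission where

open import Defs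
open import Data.Nat using (ℕ; zero; suc; _+_)
open import Data.Vec using (Vec; []; _∷_; _++_; cast)
open import Data.Vec.Properties using (∷-injectiveˡ; ∷-injectiveʳ; cast-is-id)
open import Data.Product using (Σ; _×_; _,_)
open import Data.Sum using (inj₁; inj₂)
open import Data.Empty using (⊥-elim)
open import Function.Bundles using (_⇔_; mk⇔; Equivalence)
open import Relation.Binary.PropositionalEquality

IsInf-cong : ∀ {P Q : ℕ → Set} → (∀ n → P n ⇔ Q n) → ∀ v → IsInf P v ⇔ IsInf Q v
IsInf-cong {P} {Q} P⇔Q v = mk⇔
  (λ (lb , glb) → (λ n q → lb n (Q→P n q)) , (λ w lbw → glb w (λ n p → lbw n (P→Q n p))))
  (λ (lb , glb) → (λ n p → lb n (P→Q n p)) , (λ w lbw → glb w (λ n q → lbw n (Q→P n q))))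
  where
    P→Q : ∀ n → P n → Q n
    P→Q n = Equivalence.to (P⇔Q n)
    Q→P : ∀ n → Q n → P n
    Q→P n = Equivalence.from (P⇔Q n)

module CbN (Op : Set) (ar : Op → ℕ) where
  open Theory Op ar

  levn≡lev∘cn : ∀ c → levn c ≡ lev (cn c)
  levn≡lev∘cn hole = refl
  levn≡lev∘cn (lamC c) = levn≡lev∘cn c
  levn≡lev∘cn (appL c t) = levn≡lev∘cn c
  levn≡lev∘cn (appR t c) = cong suc (levn≡lev∘cn c)
  levn≡lev∘cn (opC o eq ts c us) = cong suc (levn≡lev∘cn c)

  blam-injective : ∀ {T U} → blam T ≡ blam U → T ≡ U
  blam-injective refl = refl

  bapp-injectiveˡ : ∀ {T T′ U U′} → bapp T U ≡ bapp T′ U′ → T ≡ T′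
  bapp-injectiveˡ refl = refl

  bapp-injectiveʳ : ∀ {T T′ U U′} → bapp T U ≡ bapp T′ U′ → U ≡ U′
  bapp-injectiveʳ refl = refl

  !-injective : ∀ {T U} → ! T ≡ ! U → T ≡ U
  !-injective refl = refl

  bop-injectiveˡ : ∀ {o o′ Ts Us} → bop o Ts ≡ bop o′ Us → o ≡ o′
  bop-injectiveˡ refl = refl

  bop-injectiveʳ : ∀ {o Ts Us} → bop o Ts ≡ bop o Us → Ts ≡ Us
  bop-injectiveʳ refl = refl

  mutual
    erase : B → Λ
    erase (bvar x) = var x
    erase (blam T) = lam (erase T)
    erase (bapp T S) = app (erase T) (erase S)
    erase (! T) = erase T
    erase (bop o Ts) = op o (eraseV Ts)

    eraseV : ∀ {k} → Vec B k → Vec Λ k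
    eraseV [] = []
    eraseV (T ∷ Ts) = erase T ∷ eraseV Ts

  mutual
    erase∘tn : ∀ t → erase (tn t) ≡ t
    erase∘tn (var x) = refl
    erase∘tn (lam t) = cong lam (erase∘tn t)
    erase∘tn (app t s) = cong₂ app (erase∘tn t) (erase∘tn s)
    erase∘tn (op o ts) = cong (op o) (eraseV∘tnV ts)

    eraseV∘tnV : ∀ {k} (ts : Vec Λ k) → eraseV (tnV ts) ≡ ts
    eraseV∘tnV [] = refl
    eraseV∘tnV (t ∷ ts) = cong₂ _∷_ (erase∘tn t) (eraseV∘tnV ts)

  tn-injective : ∀ {t s} → tn t ≡ tn s → t ≡ s
  tn-injective {t} {s} eq = begin
    t              ≡⟨ erase∘tn t ⟨
    erase (tn t)   ≡⟨ cong erase eq ⟩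
    erase (tn s)   ≡⟨ erase∘tn s ⟩
    s              ∎
    where open ≡-Reasoning

  mutual
    tn-ren : ∀ ρ t → tn (ren ρ t) ≡ bren ρ (tn t)
    tn-ren ρ (var x) = refl
    tn-ren ρ (lam t) = cong blam (tn-ren (ext ρ) t)
    tn-ren ρ (app t s) = cong₂ (λ T S → bapp T (! S)) (tn-ren ρ t) (tn-ren ρ s)
    tn-ren ρ (op o ts) = cong (bop o) (tnV-renV ρ ts)

    tnV-renV : ∀ {k} ρ (ts : Vec Λ k) → tnV (renV ρ ts) ≡ brenV ρ (tnV ts)
    tnV-renV ρ [] = refl
    tnV-renV ρ (t ∷ ts) = cong₂ _∷_ (tn-ren ρ t) (tnV-renV ρ ts)

  tn-exts : ∀ {σ τ} → (∀ x → tn (σ x) ≡ τ x) → ∀ x → tn (exts σ x) ≡ bexts τ x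
  tn-exts σ≗τ zero = refl
  tn-exts {σ} σ≗τ (suc x) = trans (tn-ren suc (σ x)) (cong (bren suc) (σ≗τ x))

  mutual
    tn-sub : ∀ {σ τ} → (∀ x → tn (σ x) ≡ τ x) → ∀ t → tn (sub σ t) ≡ bsub τ (tn t)
    tn-sub σ≗τ (var x) = σ≗τ x
    tn-sub σ≗τ (lam t) = cong blam (tn-sub (tn-exts σ≗τ) t)
    tn-sub σ≗τ (app t s) = cong₂ (λ T S → bapp T (! S)) (tn-sub σ≗τ t) (tn-sub σ≗τ s)
    tn-sub σ≗τ (op o ts) = cong (bop o) (tnV-subV σ≗τ ts)

    tnV-subV : ∀ {k σ τ} → (∀ x → tn (σ x) ≡ τ x) →
               (ts : Vec Λ k) → tnV (subV σ ts) ≡ bsubV τ (tnV ts)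
    tnV-subV σ≗τ [] = refl
    tnV-subV σ≗τ (t ∷ ts) = cong₂ _∷_ (tn-sub σ≗τ t) (tnV-subV σ≗τ ts)

  tn-[/0] : ∀ t s → tn (t [ s /0]) ≡ tn t ⟨ tn s /0⟩
  tn-[/0] t s = tn-sub (λ { zero → refl ; (suc x) → refl }) t

  tnV-++ : ∀ {m n} (ts : Vec Λ m) (us : Vec Λ n) → tnV (ts ++ us) ≡ tnV ts ++ tnV us
  tnV-++ [] us = refl
  tnV-++ (t ∷ ts) us = cong (tn t ∷_) (tnV-++ ts us)

  tnV-cast : ∀ {m n} (eq : m ≡ n) (ts : Vec Λ m) → tnV (cast eq ts) ≡ cast eq (tnV ts)
  tnV-cast refl ts = trans (cong tnV (cast-is-id refl ts)) (sym (cast-is-id refl (tnV ts)))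

  tn-plug : ∀ c r → tn (c ⟦ r ⟧) ≡ cn c ⟪ tn r ⟫
  tn-plug hole r = refl
  tn-plug (lamC c) r = cong blam (tn-plug c r)
  tn-plug (appL c t) r = cong (λ T → bapp T (! tn t)) (tn-plug c r)
  tn-plug (appR t c) r = cong (λ S → bapp (tn t) (! S)) (tn-plug c r)
  tn-plug (opC o eq ts c us) r = cong (bop o) (begin
    tnV (cast eq (ts ++ (c ⟦ r ⟧ ∷ us)))      ≡⟨ tnV-cast eq _ ⟩
    cast eq (tnV (ts ++ (c ⟦ r ⟧ ∷ us)))      ≡⟨ cong (cast eq) (tnV-++ ts _) ⟩
    cast eq (tnV ts ++ (tn (c ⟦ r ⟧) ∷ tnV us))
      ≡⟨ cong (λ T → cast eq (tnV ts ++ (T ∷ tnV us))) (tn-plug c r) ⟩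
    cast eq (tnV ts ++ (cn c ⟪ tn r ⟫ ∷ tnV us)) ∎)
    where open ≡-Reasoning

  NotBang : B → Set
  NotBang X = ∀ Y → X ≢ ! Y

  tn-notBang : ∀ t → NotBang (tn t)
  tn-notBang (var x) Y ()
  tn-notBang (lam t) Y ()
  tn-notBang (app t s) Y ()
  tn-notBang (op o ts) Y ()

  record VecSplit {m n k} (eq : m + suc n ≡ k) (ts : Vec Λ k)
                  (Ts : Vec B m) (Y : B) (Us : Vec B n) : Set where
    constructor split
    field
      before  : Vec Λ m
      focus   : Λ
      after   : Vec Λ n
      ts≡     : ts ≡ cast eq (before ++ (focus ∷ after))
      before≡ : tnV before ≡ Ts
      focus≡  : tn focus ≡ Y
      after≡  : tnV after ≡ Us

  tnV-split : ∀ {m n} (ts : Vec Λ (m + suc n)) (Ts : Vec B m) Y (Us : Vec B n) →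
              tnV ts ≡ Ts ++ (Y ∷ Us) → VecSplit refl ts Ts Y Us
  tnV-split (t ∷ ts) [] Y Us eq =
    split [] t ts (sym (cast-is-id refl _)) refl (∷-injectiveˡ eq) (∷-injectiveʳ eq)
  tnV-split (t ∷ ts) (T ∷ Ts) Y Us eq
    with split before y after ts≡ before≡ y≡ after≡ ← tnV-split ts Ts Y Us (∷-injectiveʳ eq) =
    split (t ∷ before) y after (cong (t ∷_) ts≡) (cong₂ _∷_ (∷-injectiveˡ eq) before≡) y≡ after≡

  tnV-split-cast : ∀ {m n k} (eq : m + suc n ≡ k) (ts : Vec Λ k) Ts Y Us →
                   tnV ts ≡ cast eq (Ts ++ (Y ∷ Us)) → VecSplit eq ts Ts Y Us
  tnV-split-cast refl ts Ts Y Us eq = tnV-split ts Ts Y Us (trans eq (cast-is-id refl _))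

  record Decomposition (C : BCtx) (t : Λ) (X : B) : Set where
    constructor decomposition
    field
      ctx   : Ctx
      focus : Λ
      C≡    : C ≡ cn ctx
      t≡    : t ≡ ctx ⟦ focus ⟧
      X≡    : tn focus ≡ X

  mutual
    decompose : ∀ C t {X} → NotBang X → tn t ≡ C ⟪ X ⟫ → Decomposition C t X
    decompose bhole t nb eq = decomposition hole t refl refl eq
    decompose (blamC C) (lam t) nb eq
      with decomposition c y C≡ t≡ X≡ ← decompose C t nb (blam-injective eq) =
      decomposition (lamC c) y (cong blamC C≡) (cong lam t≡) X≡
    decompose (bappL C T) (app t s) nb eq
      with decomposition c y C≡ t≡ X≡ ← decompose C t nb (bapp-injectiveˡ eq) =
      decomposition (appL c s) y (cong₂ bappL C≡ (sym (bapp-injectiveʳ eq))) (cong₂ app t≡ refl) X≡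
    decompose (bappR T C) (app t s) nb eq = decompose-argument C t s nb eq
    decompose (!C C) t nb eq = ⊥-elim (tn-notBang t _ eq)
    decompose (bopC o eq Ts C Us) (op o′ ts) nb eq′
      with refl ← bop-injectiveˡ eq′ = decompose-operand eq Ts C Us ts nb eq′
    decompose (blamC C) (var x) nb ()
    decompose (blamC C) (app t s) nb ()
    decompose (blamC C) (op o ts) nb ()
    decompose (bappL C T) (var x) nb ()
    decompose (bappL C T) (lam t) nb ()
    decompose (bappL C T) (op o ts) nb ()
    decompose (bappR T C) (var x) nb ()
    decompose (bappR T C) (lam t) nb ()
    decompose (bappR T C) (op o ts) nb ()
    decompose (bopC o eq Ts C Us) (var x) nb ()
    decompose (bopC o eq Ts C Us) (lam t) nb ()
    decompose (bopC o eq Ts C Us) (app t s) nb ()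

    decompose-argument : ∀ C t s {T X} → NotBang X → bapp (tn t) (! tn s) ≡ bapp T (C ⟪ X ⟫) →
                         Decomposition (bappR T C) (app t s) X
    decompose-argument bhole t s nb eq = ⊥-elim (nb _ (sym (bapp-injectiveʳ eq)))
    decompose-argument (!C C) t s nb eq
      with decomposition c y C≡ s≡ X≡ ← decompose C s nb (!-injective (bapp-injectiveʳ eq)) =
      decomposition (appR t c) y (cong₂ bappR (sym (bapp-injectiveˡ eq)) (cong !C C≡))
        (cong₂ app refl s≡) X≡
    decompose-argument (blamC C) t s nb ()
    decompose-argument (bappR T C) t s nb ()
    decompose-argument (bappL C T) t s nb ()
    decompose-argument (bopC o eq Ts C Us) t s nb ()

    decompose-operand : ∀ {o m n} (eq : m + suc n ≡ ar o) Ts C Us (ts : Vec Λ (ar o)) {X} →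
                        NotBang X →
                        tn (op o ts) ≡ bop o (cast eq (Ts ++ (C ⟪ X ⟫ ∷ Us))) →
                        Decomposition (bopC o eq Ts C Us) (op o ts) X
    decompose-operand {o} eq Ts C Us ts nb eq′
      with split before y after ts≡ refl y≡ refl ← tnV-split-cast eq ts Ts _ Us (bop-injectiveʳ eq′)
      with decomposition c z C≡ y≡′ X≡ ← decompose C y nb y≡ =
      decomposition (opC o eq before c after) z (cong (λ D → bopC o eq (tnV before) D (tnV after)) C≡)
        (cong (op o) (trans ts≡ (cong (λ u → cast eq (before ++ (u ∷ after))) y≡′))) X≡

  Step : (Λ → Λ → Set) → Λ → ℕ → Λ → Set
  Step ρ t k s = Σ Ctx λ c → Σ Λ λ r → Σ Λ λ r′ →
    ρ r r′ × (t ≡ c ⟦ r ⟧) × (s ≡ c ⟦ r′ ⟧) × (levn c ≡ k)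

  BStep : (B → B → Set) → B → ℕ → B → Set
  BStep ρ T k S = Σ BCtx λ C → Σ B λ R₀ → Σ B λ R₁ →
    ρ R₀ R₁ × (T ≡ C ⟪ R₀ ⟫) × (S ≡ C ⟪ R₁ ⟫) × (lev C ≡ k)

  Occurs : (Λ → Set) → Λ → ℕ → Set
  Occurs P t k = Σ Ctx λ c → Σ Λ λ r → P r × (t ≡ c ⟦ r ⟧) × (levn c ≡ k)

  BOccurs : (B → Set) → B → ℕ → Set
  BOccurs P T k = Σ BCtx λ C → Σ B λ r → P r × (T ≡ C ⟪ r ⟫) × (lev C ≡ k)

  record Simulates (ρ : Λ → Λ → Set) (ρ! : B → B → Set) : Set where
    field
      preserve : ∀ {r r′} → ρ r r′ → ρ! (tn r) (tn r′)
      reflect  : ∀ {X Y} → ρ! X Y → ∀ r → tn r ≡ X → Σ Λ λ r′ → ρ r r′ × tn r′ ≡ Y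
      source-notBang : ∀ {X Y} → ρ! X Y → NotBang X

  module _ {ρ ρ!} (sim : Simulates ρ ρ!) where
    open Simulates sim

    Step⇔BStep-tn : ∀ t s k → Step ρ t k s ⇔ BStep ρ! (tn t) k (tn s)
    Step⇔BStep-tn t s k = mk⇔ forward backward
      where
        forward : Step ρ t k s → BStep ρ! (tn t) k (tn s)
        forward (c , r , r′ , r↦r′ , refl , refl , refl) =
          cn c , tn r , tn r′ , preserve r↦r′ , tn-plug c r , tn-plug c r′ , sym (levn≡lev∘cn c)

        backward : BStep ρ! (tn t) k (tn s) → Step ρ t k s
        backward (C , X , Y , X↦Y , t≡ , s≡ , refl)
          with decomposition c y refl refl refl ← decompose C t (source-notBang X↦Y) t≡
          with y′ , y↦y′ , refl ← reflect X↦Y y refl =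
          c , y , y′ , y↦y′ , refl , tn-injective (trans s≡ (sym (tn-plug c y′))) , levn≡lev∘cn c

  Occurs⇔BOccurs-tn : ∀ {P Q} → (∀ {r} → P r → Q (tn r)) → (∀ {r} → Q (tn r) → P r) →
                      (∀ {X} → Q X → NotBang X) → ∀ t k → Occurs P t k ⇔ BOccurs Q (tn t) k
  Occurs⇔BOccurs-tn preserve reflect notBang t k = mk⇔ forward backward
    where
      forward : Occurs _ t k → BOccurs _ (tn t) k
      forward (c , r , Pr , refl , refl) = cn c , tn r , preserve Pr , tn-plug c r , sym (levn≡lev∘cn c)

      backward : BOccurs _ (tn t) k → Occurs _ t k
      backward (C , X , QX , t≡ , refl)
        with decomposition c y refl refl refl ← decompose C t (notBang QX) t≡ =
        c , y , reflect QX , refl , levn≡lev∘cn c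

  ↦β-simulates-↦!β : Simulates _↦β_ _↦!β_
  ↦β-simulates-↦!β = record
    { preserve = preserve
    ; reflect = reflect
    ; source-notBang = λ { (!β T S) U () }
    }
    where
      preserve : ∀ {r r′} → r ↦β r′ → tn r ↦!β tn r′
      preserve (β t s) = subst (bapp (blam (tn t)) (! tn s) ↦!β_) (sym (tn-[/0] t s)) (!β (tn t) (tn s))

      reflect : ∀ {X Y} → X ↦!β Y → ∀ r → tn r ≡ X → Σ Λ λ r′ → r ↦β r′ × tn r′ ≡ Y
      reflect (!β _ _) (app (lam t) s) refl = t [ s /0] , β t s , tn-[/0] t s
      reflect (!β _ _) (var x) ()
      reflect (!β _ _) (lam t) ()
      reflect (!β _ _) (app (var x) s) ()
      reflect (!β _ _) (app (app t u) s) ()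
      reflect (!β _ _) (app (op o ts) s) ()
      reflect (!β _ _) (op o ts) ()

  module _ (R : Op → Λ → Λ → Set) where
    open Rules R

    R-simulates-BR : ∀ o → Simulates (R o) (BR o)
    R-simulates-BR o = record
      { preserve = img
      ; reflect = reflect
      ; source-notBang = λ { (img {r} _) → tn-notBang r }
      }
      where
        reflect : ∀ {X Y} → BR o X Y → ∀ r → tn r ≡ X → Σ Λ λ r′ → R o r r′ × tn r′ ≡ Y
        reflect (img {s = r′} r↦r′) r eq = r′ , subst (λ u → R o u r′) (sym (tn-injective eq)) r↦r′ , refl

    Redex⇔BRedex-tn : ∀ t k → RedexLevn t k ⇔ RedexLev (tn t) k
    Redex⇔BRedex-tn = Occurs⇔BOccurs-tn preserve reflect notBang
      where
        preserve : ∀ {r} → Redex r → BRedex (tn r)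
        preserve (inj₁ (_ , r↦r′)) = inj₁ (_ , Simulates.preserve ↦β-simulates-↦!β r↦r′)
        preserve (inj₂ (o , _ , r↦r′)) = inj₂ (o , _ , img r↦r′)

        reflect : ∀ {r} → BRedex (tn r) → Redex r
        reflect {r} (inj₁ (_ , X↦Y))
          with r′ , r↦r′ , _ ← Simulates.reflect ↦β-simulates-↦!β X↦Y r refl = inj₁ (r′ , r↦r′)
        reflect {r} (inj₂ (o , _ , X↦Y))
          with r′ , r↦r′ , _ ← Simulates.reflect (R-simulates-BR o) X↦Y r refl = inj₂ (o , r′ , r↦r′)

        notBang : ∀ {X} → BRedex X → NotBang X
        notBang (inj₁ (_ , X↦Y)) = Simulates.source-notBang ↦β-simulates-↦!β X↦Y
        notBang (inj₂ (o , _ , X↦Y)) = Simulates.source-notBang (R-simulates-BR o) X↦Y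

lemma4 : (Op : Set) (ar : Op → ℕ) → let open Theory Op ar in
         (R : Op → Λ → Λ → Set) →
         (∀ o t s → R o t s → Σ (Vec Λ (ar o)) (λ ts → t ≡ op o ts)) →
         let open Rules R in
         (∀ (c : Ctx) → levn c ≡ lev (cn c))
         × (∀ (t s : Λ) (k : ℕ) → (t →β⟨ k ⟩ s) ⇔ (tn t →!β⟨ k ⟩ tn s))
         × (∀ (o : Op) (t s : Λ) (k : ℕ) → (t →o[ o ]⟨ k ⟩ s) ⇔ (tn t →bo[ o ]⟨ k ⟩ tn s))
         × (∀ (t : Λ) (v : ℕ∞) → lln≡ t v ⇔ ll≡ (tn t) v)
lemma4 Op ar R _ =
  levn≡lev∘cn ,
  Step⇔BStep-tn ↦β-simulates-↦!β ,
  (λ o → Step⇔BStep-tn (R-simulates-BR R o)) ,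
  (λ t → IsInf-cong (Redex⇔BRedex-tn R t))
  where open CbN Op ar
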